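{- For all $\pi,\sigma\in S_n$, $\overline{(\pi\circ\sigma)^{ -1}}=\sigma^{ -1}\circ\overline{\sigma}^{ -1}\circ\overline{\pi^{ -1}}\circ\sigma$, i.e. $\overline{(\pi\circ\sigma)^{ -1}}=(\overline{\sigma}^{ -1}\circ\overline{\pi^{ -1}})^{\sigma^{ -1}}$.
   Context: Permutations are composed right to left; $\pi\in S_n$ is written $\langle \pi_1\ \cdots\ \pi_n\rangle$, $\pi_i=\pi(i)$, and identified with the permutation of $\{0,\ldots,n\}$ fixing $0$. For $\pi\in S_n$, $\overline{\pi}=(0,1,2,\ldots,n)\circ(0,\pi_n,\pi_{n-1},\ldots,\pi_1)$, a permutation of $\{0,\ldots,n\}$. For permutations $\alpha,\beta$, $\alpha^\beta=\beta\circ\alpha\circ\beta^{ -1}$. -}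

module Defs where

open import Data.Nat using (ℕ; zero; suc)
open import Data.Nat.Properties using (_≟_; <⇒≢)
open import Data.Fin using (Fin; zero; suc; toℕ; fromℕ; inject₁; lower₁)
open import Data.Fin.Properties
  using (toℕ-fromℕ; toℕ-inject₁; toℕ-injective; inject₁-lower₁; lower₁-inject₁′; toℕ<n)
open import Data.Fin.Permutation
  using (Permutation′; permutation; id; _∘ₚ_; flip; lift₀; reverse)
open import Relation.Nullary using (yes; no; contradiction)
open import Relation.Binary.PropositionalEquality using (_≡_; refl; sym; trans; cong)

-- Composition written right to left, as in the paper:
-- (α ⊙ β) i = α (β i).  (stdlib's _∘ₚ_ is diagrammatic: π ∘ₚ ρ applies π first.)
infixr 9 _⊙_
_⊙_ : ∀ {n} → Permutation′ n → Permutation′ n → Permutation′ n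
α ⊙ β = β ∘ₚ α

infix 10 _⁻¹
_⁻¹ : ∀ {n} → Permutation′ n → Permutation′ n
π ⁻¹ = flip π

_^_ : ∀ {n} → Permutation′ n → Permutation′ n → Permutation′ n
α ^ β = β ⊙ α ⊙ β ⁻¹

-- Elements of {0,…,n} are Fin (suc n); an element π ∈ S_n (acting on
-- {1,…,n} = suc-images) is identified with the permutation of {0,…,n}
-- fixing 0, i.e. lift₀ π.
ext : ∀ {n} → Permutation′ n → Permutation′ (suc n)
ext = lift₀

up : ∀ {n} → Fin (suc n) → Fin (suc n)
up {n} i with toℕ i ≟ n
... | yes _ = zero
... | no ne = suc (lower₁ i (λ e → ne (sym e)))

down : ∀ {n} → Fin (suc n) → Fin (suc n)
down {n} zero = fromℕ n
down {n} (suc j) = inject₁ j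

up-down : ∀ {n} (i : Fin (suc n)) → up (down i) ≡ i
up-down {n} zero with toℕ (fromℕ n) ≟ n
... | yes _ = refl
... | no ne = contradiction (toℕ-fromℕ n) ne
up-down {n} (suc j) with toℕ (inject₁ j) ≟ n
... | yes e = contradiction (trans (sym (toℕ-inject₁ j)) e) (<⇒≢ (toℕ<n j))
... | no ne = cong suc (lower₁-inject₁′ j _)

down-up : ∀ {n} (i : Fin (suc n)) → down (up i) ≡ i
down-up {n} i with toℕ i ≟ n
... | yes e = toℕ-injective (trans (toℕ-fromℕ n) (sym e))
... | no ne = inject₁-lower₁ i _

rot : ∀ {n} → Permutation′ (suc n)
rot = permutation up down up-down down-up

-- Cycle notation for a full cycle: given an enumeration a of {0,…,n}
-- (a permutation, listing a₀, a₁, …, aₙ as a(0), …, a(n)), the cycle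
-- (a₀, a₁, …, aₙ) maps aᵢ ↦ aᵢ₊₁ and aₙ ↦ a₀, i.e. it is a ∘ rot ∘ a⁻¹.
cycle : ∀ {n} → Permutation′ (suc n) → Permutation′ (suc n)
cycle a = a ⊙ rot ⊙ a ⁻¹

-- The sequence (0, π_n, π_{n-1}, …, π_1): position 0 holds 0, position
-- i ≥ 1 holds π_{n+1-i}.  (stdlib's reverse is j ↦ n-1-j on Fin n.)
revSeq : ∀ {n} → Permutation′ n → Permutation′ (suc n)
revSeq π = ext π ⊙ ext reverse

-- cycle id is (0,1,2,…,n).
-- π̄ = (0,1,2,…,n) ∘ (0,π_n,π_{n-1},…,π_1), a permutation of {0,…,n}.
bar : ∀ {n} → Permutation′ n → Permutation′ (suc n)
bar π = cycle id ⊙ cycle (revSeq π)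

module Submission where

-- Conjugating the rotation ρ = (0,1,…,n) by the reversal 0 ↦ 0, i ↦ n+1−i
-- inverts it, so the cycle (0, π_n, …, π_1) is π ∘ ρ⁻¹ ∘ π⁻¹ and
-- π̄ = ρ ∘ π ∘ ρ⁻¹ ∘ π⁻¹ is the commutator [ρ, π].  The identity is then
-- a computation with commutators: [ρ, (πσ)⁻¹] = σ⁻¹ ∘ [ρ, σ]⁻¹ ∘ [ρ, π⁻¹] ∘ σ.

open import Defs
open import Data.Nat using (ℕ; suc)
open import Data.Product using (_×_; _,_)
open import Data.Fin using (Fin; zero; suc; fromℕ; inject₁; opposite)
open import Data.Fin.Properties using (opposite-involutive)
open import Data.Fin.Permutation
  using (Permutation′; _≈_; _⟨$⟩ʳ_; _⟨$⟩ˡ_; reverse; inverseˡ; inverseʳ)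
open import Relation.Binary.PropositionalEquality
  using (_≡_; refl; sym; trans; cong; module ≡-Reasoning)

private
  variable
    n : ℕ

⁻¹-cong : (α β : Permutation′ n) → α ≈ β → α ⁻¹ ≈ β ⁻¹
⁻¹-cong α β α≈β i = begin
  α ⟨$⟩ˡ i                         ≡⟨ inverseˡ β ⟨
  β ⟨$⟩ˡ (β ⟨$⟩ʳ (α ⟨$⟩ˡ i))        ≡⟨ cong (β ⟨$⟩ˡ_) (α≈β (α ⟨$⟩ˡ i)) ⟨
  β ⟨$⟩ˡ (α ⟨$⟩ʳ (α ⟨$⟩ˡ i))        ≡⟨ cong (β ⟨$⟩ˡ_) (inverseʳ α) ⟩
  β ⟨$⟩ˡ i                         ∎
  where open ≡-Reasoning

[_,_] : Permutation′ n → Permutation′ n → Permutation′ n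
[ α , β ] = α ⊙ β ⊙ α ⁻¹ ⊙ β ⁻¹

commutator-congʳ : (α β γ : Permutation′ n) → β ≈ γ → [ α , β ] ≈ [ α , γ ]
commutator-congʳ α β γ β≈γ i = trans
  (cong (λ j → α ⟨$⟩ʳ (β ⟨$⟩ʳ (α ⟨$⟩ˡ j))) (⁻¹-cong β γ β≈γ i))
  (cong (α ⟨$⟩ʳ_) (β≈γ _))

commutator-⁻¹-⊙ : (ρ α β : Permutation′ n) →
  [ ρ , α ⁻¹ ⊙ β ⁻¹ ] ≈ α ⁻¹ ⊙ [ ρ , α ] ⁻¹ ⊙ [ ρ , β ⁻¹ ] ⊙ α
commutator-⁻¹-⊙ ρ α β i = begin
  ρ ⟨$⟩ʳ (α ⟨$⟩ˡ x)                                    ≡⟨ cong (λ j → ρ ⟨$⟩ʳ (α ⟨$⟩ˡ j)) (inverseˡ ρ) ⟨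
  ρ ⟨$⟩ʳ (α ⟨$⟩ˡ (ρ ⟨$⟩ˡ (ρ ⟨$⟩ʳ x)))                    ≡⟨ inverseˡ α ⟨
  α ⟨$⟩ˡ (α ⟨$⟩ʳ (ρ ⟨$⟩ʳ (α ⟨$⟩ˡ (ρ ⟨$⟩ˡ (ρ ⟨$⟩ʳ x)))))  ∎
  where
  open ≡-Reasoning
  x = β ⟨$⟩ˡ (ρ ⟨$⟩ˡ (β ⟨$⟩ʳ (α ⟨$⟩ʳ i)))

ext-⊙ : (α β : Permutation′ n) → ext (α ⊙ β) ≈ ext α ⊙ ext β
ext-⊙ α β zero    = refl
ext-⊙ α β (suc i) = refl

ext-⁻¹ : (α : Permutation′ n) → ext (α ⁻¹) ≈ ext α ⁻¹
ext-⁻¹ α zero    = refl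
ext-⁻¹ α (suc i) = refl

ext-⊙-⁻¹ : (α β : Permutation′ n) → ext ((α ⊙ β) ⁻¹) ≈ ext β ⁻¹ ⊙ ext α ⁻¹
ext-⊙-⁻¹ α β i = trans (ext-⁻¹ (α ⊙ β) i)
  (⁻¹-cong (ext (α ⊙ β)) (ext α ⊙ ext β) (ext-⊙ α β) i)

opposite-fromℕ : ∀ n → opposite (fromℕ n) ≡ zero
opposite-fromℕ ℕ.zero  = refl
opposite-fromℕ (suc n) = cong inject₁ (opposite-fromℕ n)

opposite-inject₁ : (i : Fin n) → opposite (inject₁ i) ≡ suc (opposite i)
opposite-inject₁ {suc n} zero    = refl
opposite-inject₁ {suc n} (suc i) = cong inject₁ (opposite-inject₁ i)

ext-reverse-⁻¹ : ext {n} reverse ⁻¹ ≈ ext reverse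
ext-reverse-⁻¹ zero    = refl
ext-reverse-⁻¹ (suc i) = refl

ext-reverse-involutive : (i : Fin (suc n)) →
  ext reverse ⟨$⟩ʳ (ext reverse ⟨$⟩ʳ i) ≡ i
ext-reverse-involutive zero    = refl
ext-reverse-involutive (suc i) = cong suc (opposite-involutive i)

down-reverse-down : (i : Fin (suc n)) →
  down (ext reverse ⟨$⟩ʳ down i) ≡ ext reverse ⟨$⟩ʳ i
down-reverse-down {ℕ.zero} zero          = refl
down-reverse-down {suc n}  zero          = cong (λ j → down (suc j)) (opposite-fromℕ n)
down-reverse-down {suc n}  (suc zero)    = refl
down-reverse-down {suc n}  (suc (suc i)) = cong inject₁ (opposite-inject₁ i)

reverse-up : (i : Fin (suc n)) → ext reverse ⟨$⟩ʳ up i ≡ down (ext reverse ⟨$⟩ʳ i)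
reverse-up i = begin
  ext reverse ⟨$⟩ʳ up i                       ≡⟨ down-reverse-down (up i) ⟨
  down (ext reverse ⟨$⟩ʳ down (up i))         ≡⟨ cong (λ j → down (ext reverse ⟨$⟩ʳ j)) (down-up i) ⟩
  down (ext reverse ⟨$⟩ʳ i)                   ∎
  where open ≡-Reasoning

rot-conjugate-reverse : ext reverse ⊙ rot ⊙ ext reverse ≈ rot {n} ⁻¹
rot-conjugate-reverse i = begin
  ext reverse ⟨$⟩ʳ up (ext reverse ⟨$⟩ʳ i)     ≡⟨ reverse-up (ext reverse ⟨$⟩ʳ i) ⟩
  down (ext reverse ⟨$⟩ʳ (ext reverse ⟨$⟩ʳ i)) ≡⟨ cong down (ext-reverse-involutive i) ⟩
  down i                                      ∎
  where open ≡-Reasoning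

bar≈commutator : (π : Permutation′ n) → bar π ≈ [ rot , ext π ]
bar≈commutator π i = begin
  up (P (R (up (ext reverse ⟨$⟩ˡ P⁻ i)))) ≡⟨ cong (λ j → up (P (R (up j)))) (ext-reverse-⁻¹ (P⁻ i)) ⟩
  up (P (R (up (R (P⁻ i)))))              ≡⟨ cong (λ j → up (P j)) (rot-conjugate-reverse (P⁻ i)) ⟩
  up (P (down (P⁻ i)))                    ∎
  where
  open ≡-Reasoning
  R = ext reverse ⟨$⟩ʳ_
  P = ext π ⟨$⟩ʳ_
  P⁻ = ext π ⟨$⟩ˡ_

bar-⁻¹≈commutator : (π : Permutation′ n) → bar (π ⁻¹) ≈ [ rot , ext π ⁻¹ ]
bar-⁻¹≈commutator π i = trans (bar≈commutator (π ⁻¹) i)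
  (commutator-congʳ rot (ext (π ⁻¹)) (ext π ⁻¹) (ext-⁻¹ π) i)

bar-⊙-⁻¹ : (π σ : Permutation′ n) →
  bar ((π ⊙ σ) ⁻¹) ≈ ext (σ ⁻¹) ⊙ (bar σ) ⁻¹ ⊙ bar (π ⁻¹) ⊙ ext σ
bar-⊙-⁻¹ π σ i = begin
  bar ((π ⊙ σ) ⁻¹) ⟨$⟩ʳ i
    ≡⟨ bar≈commutator ((π ⊙ σ) ⁻¹) i ⟩
  [ rot , ext ((π ⊙ σ) ⁻¹) ] ⟨$⟩ʳ i
    ≡⟨ commutator-congʳ rot (ext ((π ⊙ σ) ⁻¹)) (ext σ ⁻¹ ⊙ ext π ⁻¹) (ext-⊙-⁻¹ π σ) i ⟩
  [ rot , ext σ ⁻¹ ⊙ ext π ⁻¹ ] ⟨$⟩ʳ i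
    ≡⟨ commutator-⁻¹-⊙ rot (ext σ) (ext π) i ⟩
  ext σ ⟨$⟩ˡ ([ rot , ext σ ] ⟨$⟩ˡ ([ rot , ext π ⁻¹ ] ⟨$⟩ʳ (ext σ ⟨$⟩ʳ i)))
    ≡⟨ cong (λ j → ext σ ⟨$⟩ˡ ([ rot , ext σ ] ⟨$⟩ˡ j)) (bar-⁻¹≈commutator π (ext σ ⟨$⟩ʳ i)) ⟨
  ext σ ⟨$⟩ˡ ([ rot , ext σ ] ⟨$⟩ˡ x)
    ≡⟨ cong (ext σ ⟨$⟩ˡ_) (⁻¹-cong (bar σ) [ rot , ext σ ] (bar≈commutator σ) x) ⟨
  ext σ ⟨$⟩ˡ (bar σ ⟨$⟩ˡ x)
    ≡⟨ ext-⁻¹ σ _ ⟨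
  ext (σ ⁻¹) ⟨$⟩ʳ (bar σ ⟨$⟩ˡ x) ∎
  where
  open ≡-Reasoning
  x = bar (π ⁻¹) ⟨$⟩ʳ (ext σ ⟨$⟩ʳ i)

corollary1 : (n : ℕ) (π σ : Permutation′ n) →
    (bar ((π ⊙ σ) ⁻¹) ≈ ext (σ ⁻¹) ⊙ (bar σ) ⁻¹ ⊙ bar (π ⁻¹) ⊙ ext σ)
    × (bar ((π ⊙ σ) ⁻¹) ≈ ((bar σ) ⁻¹ ⊙ bar (π ⁻¹)) ^ ext (σ ⁻¹))
corollary1 n π σ = bar-⊙-⁻¹ π σ , λ i → trans (bar-⊙-⁻¹ π σ i)
  (cong (ext (σ ⁻¹) ⊙ (bar σ) ⁻¹ ⊙ bar (π ⁻¹) ⟨$⟩ʳ_)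
        (sym (⁻¹-cong (ext (σ ⁻¹)) (ext σ ⁻¹) (ext-⁻¹ σ) i)))
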